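{- For any graph $G$, any $S\subseteq V(G)$, any maximal matching $M$ in $G$, and any integer $q\ge 2$, $$|M|\le \chi'_q(G,S)\le \chi'_q(G)\le 2q|M|.$$
   Context: Colours are non-negative integers; colour $0$ is special. For an edge colouring $f$ of $G$, write $f(v)=\{f(e): e\text{ incident with }v\}$. An edge $q$-colouring of $G$ is an edge colouring with $|f(v)|\le q$ for every vertex $v$. $\chi'_q(G)$ is the maximum number of distinct colours used by an edge $q$-colouring of $G$. For $S\subseteq V(G)$, an edge $q$-colouring is $S$-composable if $|f(v)\setminus\{0\}|\le q-1$ for every $v\in S$, and $\chi'_q(G,S)$ is the maximum number of non-zero colours used by an $S$-composable edge $q$-colouring of $G$. A matching is maximal if it is not a proper subset of another matching. -}

module Defs where

open import Data.Nat using (ℕ; _≤_; _∸_)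
open import Data.Nat.Properties using (_≟_)
open import Data.Fin using (Fin)
open import Data.Fin.Subset using (Subset; _∈_; _⊆_)
open import Data.Fin.Properties renaming (_≟_ to _≟ᶠ_)
open import Data.List using (List; length; map; filter; deduplicate; allFin)
open import Data.Product using (Σ; _×_; _,_; proj₁; proj₂)
open import Data.Sum using (_⊎_)
open import Relation.Binary.PropositionalEquality using (_≡_)
open import Relation.Nullary using (¬_; ¬?)
open import Relation.Nullary.Decidable using (_⊎-dec_)

record Graph : Set where
  field
    n    : ℕ
    m    : ℕ
    ends : Fin m → Fin n × Fin n
    loopless : ∀ e → ¬ (proj₁ (ends e) ≡ proj₂ (ends e))
    simple   : ∀ e e′ →
               ((proj₁ (ends e) ≡ proj₁ (ends e′) × proj₂ (ends e) ≡ proj₂ (ends e′))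
                ⊎ (proj₁ (ends e) ≡ proj₂ (ends e′) × proj₂ (ends e) ≡ proj₁ (ends e′)))
               → e ≡ e′
open Graph public

Incident : (G : Graph) → Fin (n G) → Fin (m G) → Set
Incident G v e = (v ≡ proj₁ (ends G e)) ⊎ (v ≡ proj₂ (ends G e))

ShareEnd : (G : Graph) → Fin (m G) → Fin (m G) → Set
ShareEnd G e e′ = Σ (Fin (n G)) λ v → Incident G v e × Incident G v e′

EdgeColouring : Graph → Set
EdgeColouring G = Fin (m G) → ℕ

distinct : List ℕ → List ℕ
distinct = deduplicate _≟_

coloursAt : (G : Graph) → EdgeColouring G → Fin (n G) → List ℕ
coloursAt G f v =
  distinct (map f (filter (λ e → (v ≟ᶠ proj₁ (ends G e)) ⊎-dec (v ≟ᶠ proj₂ (ends G e)))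
                          (allFin (m G))))

nonzero : List ℕ → List ℕ
nonzero = filter (λ c → ¬? (c ≟ 0))

deg-col : (G : Graph) → EdgeColouring G → Fin (n G) → ℕ
deg-col G f v = length (coloursAt G f v)

deg-col⁺ : (G : Graph) → EdgeColouring G → Fin (n G) → ℕ
deg-col⁺ G f v = length (nonzero (coloursAt G f v))

numColours : (G : Graph) → EdgeColouring G → ℕ
numColours G f = length (distinct (map f (allFin (m G))))

numNonzeroColours : (G : Graph) → EdgeColouring G → ℕ
numNonzeroColours G f = length (nonzero (distinct (map f (allFin (m G)))))

IsEdgeQColouring : (q : ℕ) (G : Graph) → EdgeColouring G → Set
IsEdgeQColouring q G f = ∀ v → deg-col G f v ≤ q

IsSComposable : (q : ℕ) (G : Graph) (S : Subset (n G)) → EdgeColouring G → Set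
IsSComposable q G S f =
  IsEdgeQColouring q G f × (∀ v → v ∈ S → deg-col⁺ G f v ≤ q ∸ 1)

IsChiQ : (q : ℕ) (G : Graph) → ℕ → Set
IsChiQ q G k =
  (Σ (EdgeColouring G) λ f → IsEdgeQColouring q G f × numColours G f ≡ k)
  × (∀ f → IsEdgeQColouring q G f → numColours G f ≤ k)

IsChiQS : (q : ℕ) (G : Graph) (S : Subset (n G)) → ℕ → Set
IsChiQS q G S k =
  (Σ (EdgeColouring G) λ f → IsSComposable q G S f × numNonzeroColours G f ≡ k)
  × (∀ f → IsSComposable q G S f → numNonzeroColours G f ≤ k)

IsMatching : (G : Graph) → Subset (m G) → Set
IsMatching G M = ∀ e e′ → e ∈ M → e′ ∈ M → ShareEnd G e e′ → e ≡ e′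

IsMaximalMatching : (G : Graph) → Subset (m G) → Set
IsMaximalMatching G M =
  IsMatching G M × (∀ M′ → IsMatching G M′ → M ⊆ M′ → M′ ⊆ M)

-- Lower bound: colour each edge of M with its own non-zero colour and every other edge with 0.
-- Since M is a matching, a vertex sees at most the colour 0 and one further colour, so this
-- colouring is S-composable for q ≥ 2 and uses |M| non-zero colours.
-- Upper bound: by maximality every edge shares an endpoint with an edge of M, so every colour
-- of an edge q-colouring occurs at one of the 2|M| ends of M, each of which sees at most q colours.
-- The maxima χ'_q(G) and χ'_q(G,S) exist because a colouring can be renamed, without changing
-- any of the counts involved, into one with colours in {0, …, |E(G)|}, and there are only
-- finitely many of those.
module Submission where

open import Defs
open import Data.Nat using (ℕ; zero; suc; _≤_; _*_; _+_; _∸_; z≤n; s≤s; _≤?_)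
open import Data.Nat.Properties
  using (_≟_; ≤-trans; suc-injective; n≤0⇒n≡0; ≤∧≢⇒<; m<1+n⇒m≤n; +-mono-≤; +-identityʳ; *-suc; ∸-monoˡ-≤)
open import Data.Fin using (Fin; toℕ) renaming (zero to fzero; suc to fsuc)
open import Data.Fin.Properties using (any?; all?; toℕ-injective) renaming (suc-injective to fsuc-injective; _≟_ to _≟ᶠ_)
open import Data.Fin.Subset using (Subset; ∣_∣; _∈_; _∪_; ⁅_⁆; inside; outside)
open import Data.Fin.Subset.Properties using (_∈?_; x∈⁅x⁆; x∈⁅y⁆⇒x≡y; x∈p∪q⁻; x∈p∪q⁺; p⊆p∪q)
import Data.Vec.Base as Vec
open Vec using (Vec; lookup; tabulate)
open import Data.Vec.Properties using (lookup∘tabulate)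
open import Data.List using (List; []; _∷_; length; map; filter; deduplicate; _++_; allFin; concatMap)
open import Data.List.Properties
  using (filter-≐; length-map; length-++; length-++-sucʳ; length-filter; length-deduplicate; length-tabulate)
open import Data.List.Membership.Propositional using () renaming (_∈_ to _∈ˡ_)
open import Data.List.Relation.Binary.Subset.Propositional using () renaming (_⊆_ to _⊆ˡ_)
open import Data.List.Membership.Propositional.Properties
  using (∈-map⁺; ∈-map⁻; ∈-filter⁺; ∈-filter⁻; ∈-allFin; ∈-deduplicate⁺; ∈-deduplicate⁻;
         ∈-∃++; ∈-++⁻; ∈-++⁺ˡ; ∈-++⁺ʳ; ∈-concat⁺′; ∈-map∘filter⁺; ∈-map∘filter⁻)
open import Data.List.Relation.Unary.Any using (here; there)
import Data.List.Relation.Unary.All as All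
open import Data.List.Relation.Unary.AllPairs using ([]; _∷_)
open import Data.List.Relation.Unary.Unique.Propositional using (Unique)
open import Data.List.Relation.Unary.Unique.DecPropositional.Properties _≟_ using (deduplicate-!; filter⁺; map⁺)
open import Data.Bool using (true; false)
open import Data.Product using (Σ; ∃; _×_; _,_; proj₁; proj₂)
open import Data.Sum using (inj₁; inj₂)
open import Function using (_∘_; id; _⇔_; mk⇔; Equivalence)
open import Level using (Level)
open import Relation.Binary using (Rel) renaming (Decidable to Decidable₂)
open import Relation.Binary.PropositionalEquality using (_≡_; _≢_; refl; sym; trans; cong; subst; subst₂; _≗_; module ≡-Reasoning)
open import Relation.Nullary using (Dec; yes; no; ¬?; contradiction; contraposition)
import Relation.Nullary.Decidable as Dec
open import Relation.Nullary.Decidable using (_×-dec_; _⊎-dec_; _→-dec_)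
open import Relation.Unary using (Pred; Decidable; _≐_)

open Equivalence using (to; from)

private
  variable
    a ℓ r s : Level
    A B : Set a

filter-map : ∀ {P : Pred B ℓ} (P? : Decidable P) (f : A → B) xs →
             filter P? (map f xs) ≡ map f (filter (P? ∘ f) xs)
filter-map P? f [] = refl
filter-map P? f (x ∷ xs) with Dec.does (P? (f x))
... | true  = cong (f x ∷_) (filter-map P? f xs)
... | false = filter-map P? f xs

deduplicate-map : ∀ {R : Rel B r} (R? : Decidable₂ R) (f : A → B) xs →
                  deduplicate R? (map f xs) ≡ map f (deduplicate (λ x y → R? (f x) (f y)) xs)
deduplicate-map R? f [] = refl
deduplicate-map {A = A} R? f (x ∷ xs) = cong (f x ∷_) (begin
  filter (¬? ∘ R? (f x)) (deduplicate R? (map f xs))  ≡⟨ cong (filter _) (deduplicate-map R? f xs) ⟩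
  filter (¬? ∘ R? (f x)) (map f ys)                   ≡⟨ filter-map (¬? ∘ R? (f x)) f ys ⟩
  map f (filter (¬? ∘ R? (f x) ∘ f) ys)               ∎)
  where
  open ≡-Reasoning
  ys : List A
  ys = deduplicate (λ x y → R? (f x) (f y)) xs

deduplicate-⇔ : ∀ {R : Rel A r} {R′ : Rel A s} (R? : Decidable₂ R) (R′? : Decidable₂ R′) →
                (∀ x y → R x y ⇔ R′ x y) → deduplicate R? ≗ deduplicate R′?
deduplicate-⇔ R? R′? R⇔R′ [] = refl
deduplicate-⇔ R? R′? R⇔R′ (x ∷ xs) = cong (x ∷_) (trans
  (cong (filter (¬? ∘ R? x)) (deduplicate-⇔ R? R′? R⇔R′ xs))
  (filter-≐ (¬? ∘ R? x) (¬? ∘ R′? x) (contraposition (from (R⇔R′ x _)) , contraposition (to (R⇔R′ x _)))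
            (deduplicate R′? xs)))

Unique-⊆⇒length≤ : ∀ {xs ys : List A} → Unique xs → xs ⊆ˡ ys → length xs ≤ length ys
Unique-⊆⇒length≤ [] _ = z≤n
Unique-⊆⇒length≤ {xs = x ∷ xs} (x∉xs ∷ unique-xs) xs⊆ys with ∈-∃++ (xs⊆ys (here refl))
... | as , bs , refl =
  subst (suc (length xs) ≤_) (sym (length-++-sucʳ as x bs)) (s≤s (Unique-⊆⇒length≤ unique-xs xs⊆as++bs))
  where
  xs⊆as++bs : xs ⊆ˡ as ++ bs
  xs⊆as++bs {z} z∈xs with ∈-++⁻ as (xs⊆ys (there z∈xs))
  ... | inj₁ z∈as         = ∈-++⁺ˡ z∈as
  ... | inj₂ (here refl)  = contradiction refl (All.lookup x∉xs z∈xs)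
  ... | inj₂ (there z∈bs) = ∈-++⁺ʳ as z∈bs

Unique-constant⇒length≤1 : ∀ {xs : List A} → Unique xs → (∀ {x y} → x ∈ˡ xs → y ∈ˡ xs → x ≡ y) →
                           length xs ≤ 1
Unique-constant⇒length≤1 [] _ = z≤n
Unique-constant⇒length≤1 (_ ∷ []) _ = s≤s z≤n
Unique-constant⇒length≤1 ((x≢y All.∷ _) ∷ _) constant =
  contradiction (constant (here refl) (there (here refl))) x≢y

nonzero? : (c : ℕ) → Dec (c ≢ 0)
nonzero? c = ¬? (c ≟ 0)

Unique⇒length≤1+nonzero : ∀ {xs} → Unique xs → length xs ≤ suc (length (nonzero xs))
Unique⇒length≤1+nonzero {xs} unique = Unique-⊆⇒length≤ unique xs⊆0∷nonzero
  where
  xs⊆0∷nonzero : xs ⊆ˡ 0 ∷ nonzero xs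
  xs⊆0∷nonzero {c} c∈xs with c ≟ 0
  ... | yes c≡0 = here c≡0
  ... | no  c≢0 = there (∈-filter⁺ nonzero? c∈xs c≢0)

length-concatMap-≤ : ∀ (h : A → List B) {c} → (∀ x → length (h x) ≤ c) →
                     ∀ xs → length (concatMap h xs) ≤ c * length xs
length-concatMap-≤ h bound [] = z≤n
length-concatMap-≤ h {c} bound (x ∷ xs) = begin
  length (h x ++ concatMap h xs)       ≡⟨ length-++ (h x) ⟩
  length (h x) + length (concatMap h xs) ≤⟨ +-mono-≤ (bound x) (length-concatMap-≤ h bound xs) ⟩
  c + c * length xs                    ≡⟨ sym (*-suc c (length xs)) ⟩
  c * suc (length xs)                  ∎
  where open Data.Nat.Properties.≤-Reasoning

members : ∀ {k} → Subset k → List (Fin k)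
members Vec.[] = []
members (inside  Vec.∷ p) = fzero ∷ map fsuc (members p)
members (outside Vec.∷ p) = map fsuc (members p)

length-members : ∀ {k} (p : Subset k) → length (members p) ≡ ∣ p ∣
length-members Vec.[] = refl
length-members (inside  Vec.∷ p) = cong suc (trans (length-map fsuc (members p)) (length-members p))
length-members (outside Vec.∷ p) = trans (length-map fsuc (members p)) (length-members p)

∈-members⁺ : ∀ {k} {p : Subset k} {i} → i ∈ p → i ∈ˡ members p
∈-members⁺ {p = inside  Vec.∷ p} Vec.here      = here refl
∈-members⁺ {p = inside  Vec.∷ p} (Vec.there i∈p) = there (∈-map⁺ fsuc (∈-members⁺ i∈p))
∈-members⁺ {p = outside Vec.∷ p} (Vec.there i∈p) = ∈-map⁺ fsuc (∈-members⁺ i∈p)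

∈-members⁻ : ∀ {k} (p : Subset k) {i} → i ∈ˡ members p → i ∈ p
∈-members⁻ (inside Vec.∷ p) (here refl) = Vec.here
∈-members⁻ (inside Vec.∷ p) (there i∈) with ∈-map⁻ fsuc i∈
... | _ , j∈ , refl = Vec.there (∈-members⁻ p j∈)
∈-members⁻ (outside Vec.∷ p) i∈ with ∈-map⁻ fsuc i∈
... | _ , j∈ , refl = Vec.there (∈-members⁻ p j∈)

members-unique : ∀ {k} (p : Subset k) → Unique (members p)
members-unique Vec.[] = []
members-unique (inside  Vec.∷ p) = fzero∉ (members p) ∷ map⁺ fsuc-injective (members-unique p)
  where
  fzero∉ : ∀ {k} (is : List (Fin k)) → All.All (fzero ≢_) (map fsuc is)
  fzero∉ [] = All.[]
  fzero∉ (_ ∷ is) = (λ ()) All.∷ fzero∉ is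
members-unique (outside Vec.∷ p) = map⁺ fsuc-injective (members-unique p)

record _≅₀_ {A : Set a} (f g : A → ℕ) : Set a where
  field
    alike : ∀ x y → (f x ≡ f y) ⇔ (g x ≡ g y)
    zeros : ∀ x → (f x ≡ 0) ⇔ (g x ≡ 0)
open _≅₀_

classRepresentatives : (A → ℕ) → List A → List A
classRepresentatives f = deduplicate (λ x y → f x ≟ f y)

distinct-map : ∀ (f : A → ℕ) xs → distinct (map f xs) ≡ map f (classRepresentatives f xs)
distinct-map = deduplicate-map _≟_

module _ {f g : A → ℕ} (f≅g : f ≅₀ g) where

  ≅₀-classRepresentatives : classRepresentatives f ≗ classRepresentatives g
  ≅₀-classRepresentatives = deduplicate-⇔ _ _ (alike f≅g)

  ≅₀-length-distinct : ∀ xs → length (distinct (map f xs)) ≡ length (distinct (map g xs))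
  ≅₀-length-distinct xs = begin
    length (distinct (map f xs))  ≡⟨ cong length (distinct-map f xs) ⟩
    length (map f rf)             ≡⟨ length-map f rf ⟩
    length rf                     ≡⟨ cong length (≅₀-classRepresentatives xs) ⟩
    length rg                     ≡⟨ sym (length-map g rg) ⟩
    length (map g rg)             ≡⟨ cong length (sym (distinct-map g xs)) ⟩
    length (distinct (map g xs))  ∎
    where
    open ≡-Reasoning
    rf rg : List A
    rf = classRepresentatives f xs
    rg = classRepresentatives g xs

  ≅₀-length-nonzero : ∀ xs → length (nonzero (distinct (map f xs))) ≡ length (nonzero (distinct (map g xs)))
  ≅₀-length-nonzero xs = begin
    length (nonzero (distinct (map f xs)))     ≡⟨ cong (length ∘ nonzero) (distinct-map f xs) ⟩
    length (nonzero (map f rf))                ≡⟨ cong length (filter-map nonzero? f rf) ⟩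
    length (map f (filter (nonzero? ∘ f) rf))  ≡⟨ length-map f (filter (nonzero? ∘ f) rf) ⟩
    length (filter (nonzero? ∘ f) rf)          ≡⟨ cong (length ∘ filter (nonzero? ∘ f)) (≅₀-classRepresentatives xs) ⟩
    length (filter (nonzero? ∘ f) rg)          ≡⟨ cong length (filter-≐ (nonzero? ∘ f) (nonzero? ∘ g) nonzero⇔ rg) ⟩
    length (filter (nonzero? ∘ g) rg)          ≡⟨ sym (length-map g (filter (nonzero? ∘ g) rg)) ⟩
    length (map g (filter (nonzero? ∘ g) rg))  ≡⟨ cong length (sym (filter-map nonzero? g rg)) ⟩
    length (nonzero (map g rg))                ≡⟨ cong (length ∘ nonzero) (sym (distinct-map g xs)) ⟩
    length (nonzero (distinct (map g xs)))     ∎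
    where
    open ≡-Reasoning
    rf rg : List A
    rf = classRepresentatives f xs
    rg = classRepresentatives g xs
    nonzero⇔ : (λ x → f x ≢ 0) ≐ (λ x → g x ≢ 0)
    nonzero⇔ = contraposition (from (zeros f≅g _)) , contraposition (to (zeros f≅g _))

module _ {k} (f : Fin k → ℕ) where

  label : ℕ → Fin (suc k)
  label c with c ≟ 0 | any? (λ i → f i ≟ c)
  ... | yes _ | _           = fzero
  ... | no _  | yes (i , _) = fsuc i
  ... | no _  | no _        = fzero

  data LabelView (c : ℕ) : Fin (suc k) → Set where
    zero-colour : c ≡ 0 → LabelView c fzero
    edge-colour : ∀ i → c ≢ 0 → f i ≡ c → LabelView c (fsuc i)

  label-view : ∀ e → LabelView (f e) (label (f e))
  label-view e with f e ≟ 0 | any? (λ i → f i ≟ f e)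
  ... | yes fe≡0 | _             = zero-colour fe≡0
  ... | no fe≢0  | yes (i , fi≡) = edge-colour i fe≢0 fi≡
  ... | no _     | no none       = contradiction (e , refl) none

  label-injective : ∀ e e′ → label (f e) ≡ label (f e′) → f e ≡ f e′
  label-injective e e′ eq with label (f e) | label-view e | label (f e′) | label-view e′
  label-injective e e′ refl | _ | zero-colour fe≡0     | _ | zero-colour fe′≡0      = trans fe≡0 (sym fe′≡0)
  label-injective e e′ refl | _ | edge-colour i _ fi≡  | _ | edge-colour .i _ fi≡′ = trans (sym fi≡) fi≡′

  toℕ-label≡0⇔ : ∀ e → (f e ≡ 0) ⇔ (toℕ (label (f e)) ≡ 0)
  toℕ-label≡0⇔ e with label (f e) | label-view e
  ... | _ | zero-colour fe≡0       = mk⇔ (λ _ → refl) (λ _ → fe≡0)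
  ... | _ | edge-colour i fe≢0 _   = mk⇔ (λ fe≡0 → contradiction fe≡0 fe≢0) (λ ())

  normalise : Vec (Fin (suc k)) k
  normalise = tabulate (label ∘ f)

  ≅₀-normalise : f ≅₀ (toℕ ∘ lookup normalise)
  ≅₀-normalise = record
    { alike = λ e e′ → subst₂ (λ x y → (f e ≡ f e′) ⇔ (toℕ x ≡ toℕ y))
                         (sym (lookup∘tabulate (label ∘ f) e)) (sym (lookup∘tabulate (label ∘ f) e′))
                         (mk⇔ (cong (toℕ ∘ label)) (label-injective e e′ ∘ toℕ-injective))
    ; zeros = λ e → subst (λ x → (f e ≡ 0) ⇔ (toℕ x ≡ 0)) (sym (lookup∘tabulate (label ∘ f) e)) (toℕ-label≡0⇔ e)
    }

any-Vec? : ∀ {n k} {P : Pred (Vec (Fin n) k) ℓ} → Decidable P → Dec (∃ P)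
any-Vec? {k = zero}  P? = Dec.map′ (Vec.[] ,_) (λ { (Vec.[] , p) → p }) (P? Vec.[])
any-Vec? {k = suc k} P? =
  Dec.map′ (λ (x , xs , p) → x Vec.∷ xs , p) (λ { (x Vec.∷ xs , p) → x , xs , p })
           (any? λ x → any-Vec? (λ xs → P? (x Vec.∷ xs)))

greatest : ∀ {P : Pred ℕ ℓ} → Decidable P → ∀ bound → (∀ {n} → P n → n ≤ bound) →
           ∀ {a} → P a → ∃ λ n → P n × (∀ {m} → P m → m ≤ n)
greatest {P = P} P? bound ≤bound pa with P? bound
... | yes p-bound = bound , p-bound , ≤bound
greatest {P = P} P? zero ≤bound pa | no ¬p-bound = contradiction (subst P (n≤0⇒n≡0 (≤bound pa)) pa) ¬p-bound
greatest {P = P} P? (suc bound) ≤bound pa | no ¬p-bound = greatest P? bound ≤bound′ pa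
  where
  ≤bound′ : ∀ {n} → P n → n ≤ bound
  ≤bound′ pn = m<1+n⇒m≤n (≤∧≢⇒< (≤bound pn) λ { refl → ¬p-bound pn })

module _ {k} (Q : (Fin k → ℕ) → Set) (Q? : ∀ f → Dec (Q f)) (N : (Fin k → ℕ) → ℕ)
         (≅₀-Q : ∀ {f g} → f ≅₀ g → Q f → Q g) (≅₀-N : ∀ {f g} → f ≅₀ g → N f ≡ N g)
         (N≤k : ∀ f → N f ≤ k) where

  private
    Attained : ℕ → Set
    Attained n = ∃ λ (v : Vec (Fin (suc k)) k) → Q (toℕ ∘ lookup v) × N (toℕ ∘ lookup v) ≡ n

    attained? : ∀ n → Dec (Attained n)
    attained? n = any-Vec? λ v → Q? (toℕ ∘ lookup v) ×-dec (N (toℕ ∘ lookup v) ≟ n)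

    attained≤k : ∀ {n} → Attained n → n ≤ k
    attained≤k (v , _ , refl) = N≤k (toℕ ∘ lookup v)

    attained : ∀ f → Q f → Attained (N f)
    attained f qf = normalise f , ≅₀-Q (≅₀-normalise f) qf , sym (≅₀-N (≅₀-normalise f))

  maximum-attained : ∀ {f} → Q f →
    Σ ℕ λ n → (Σ (Fin k → ℕ) λ g → Q g × N g ≡ n) × (∀ g → Q g → N g ≤ n)
  maximum-attained {f} qf with greatest attained? k attained≤k (attained f qf)
  ... | n , (v , qv , Nv≡n) , max = n , (toℕ ∘ lookup v , qv , Nv≡n) , λ g qg → max (attained g qg)

module _ (G : Graph) where

  incident? : ∀ v e → Dec (Incident G v e)
  incident? v e = (v ≟ᶠ proj₁ (ends G e)) ⊎-dec (v ≟ᶠ proj₂ (ends G e))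

  incidentEdges : Fin (n G) → List (Fin (m G))
  incidentEdges v = filter (incident? v) (allFin (m G))

  shareEnd? : ∀ e e′ → Dec (ShareEnd G e e′)
  shareEnd? e e′ = any? λ v → incident? v e ×-dec incident? v e′

  shareEnd-sym : ∀ {e e′} → ShareEnd G e e′ → ShareEnd G e′ e
  shareEnd-sym (v , v~e , v~e′) = v , v~e′ , v~e

  module _ (f : EdgeColouring G) where

    ∈-coloursAt⁺ : ∀ {v e} → Incident G v e → f e ∈ˡ coloursAt G f v
    ∈-coloursAt⁺ {v} {e} v~e =
      ∈-deduplicate⁺ _≟_ (∈-map∘filter⁺ f (incident? v) {xs = allFin (m G)} (e , ∈-allFin e , refl , v~e))

    ∈-coloursAt⁻ : ∀ {v c} → c ∈ˡ coloursAt G f v → ∃ λ e → Incident G v e × c ≡ f e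
    ∈-coloursAt⁻ {v} c∈
      with ∈-map∘filter⁻ f (incident? v) {xs = allFin (m G)} (∈-deduplicate⁻ _≟_ (map f (incidentEdges v)) c∈)
    ... | e , _ , c≡fe , v~e = e , v~e , c≡fe

  module _ {f g : EdgeColouring G} (f≅g : f ≅₀ g) where

    ≅₀-IsEdgeQColouring : ∀ {q} → IsEdgeQColouring q G f → IsEdgeQColouring q G g
    ≅₀-IsEdgeQColouring qf v = subst (_≤ _) (≅₀-length-distinct f≅g (incidentEdges v)) (qf v)

    ≅₀-IsSComposable : ∀ {q S} → IsSComposable q G S f → IsSComposable q G S g
    ≅₀-IsSComposable (qf , sf) =
      ≅₀-IsEdgeQColouring qf , λ v v∈S → subst (_≤ _) (≅₀-length-nonzero f≅g (incidentEdges v)) (sf v v∈S)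

  IsEdgeQColouring? : ∀ q f → Dec (IsEdgeQColouring q G f)
  IsEdgeQColouring? q f = all? λ v → deg-col G f v ≤? q

  IsSComposable? : ∀ q S f → Dec (IsSComposable q G S f)
  IsSComposable? q S f = IsEdgeQColouring? q f ×-dec all? λ v → (v ∈? S) →-dec (deg-col⁺ G f v ≤? q ∸ 1)

  numColours≤m : ∀ f → numColours G f ≤ m G
  numColours≤m f = begin
    length (distinct (map f (allFin (m G)))) ≤⟨ length-deduplicate _≟_ (map f (allFin (m G))) ⟩
    length (map f (allFin (m G)))            ≡⟨ length-map f (allFin (m G)) ⟩
    length (allFin (m G))                    ≡⟨ length-tabulate id ⟩
    m G                                      ∎
    where open Data.Nat.Properties.≤-Reasoning

  numNonzeroColours≤numColours : ∀ f → numNonzeroColours G f ≤ numColours G f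
  numNonzeroColours≤numColours f = length-filter nonzero? (distinct (map f (allFin (m G))))

  χ′-exists : ∀ {q f} → IsEdgeQColouring q G f → Σ ℕ (IsChiQ q G)
  χ′-exists {q} = maximum-attained (IsEdgeQColouring q G) (IsEdgeQColouring? q) (numColours G)
    (λ f≅g → ≅₀-IsEdgeQColouring f≅g) (λ f≅g → ≅₀-length-distinct f≅g (allFin (m G))) numColours≤m

  χ′ₛ-exists : ∀ {q S f} → IsSComposable q G S f → Σ ℕ (IsChiQS q G S)
  χ′ₛ-exists {q} {S} = maximum-attained (IsSComposable q G S) (IsSComposable? q S) (numNonzeroColours G)
    (λ f≅g → ≅₀-IsSComposable f≅g) (λ f≅g → ≅₀-length-nonzero f≅g (allFin (m G)))
    (λ f → ≤-trans (numNonzeroColours≤numColours f) (numColours≤m f))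

  χ′ₛ≤χ′ : ∀ {q S kS k} → IsChiQS q G S kS → IsChiQ q G k → kS ≤ k
  χ′ₛ≤χ′ ((f , (qf , _) , refl) , _) (_ , χ′-max) = ≤-trans (numNonzeroColours≤numColours f) (χ′-max f qf)

matchingColouring : ∀ {k} → Subset k → Fin k → ℕ
matchingColouring M e with e ∈? M
... | yes _ = suc (toℕ e)
... | no  _ = 0

matchingColouring-∈ : ∀ {k} {M : Subset k} {e} → e ∈ M → matchingColouring M e ≡ suc (toℕ e)
matchingColouring-∈ {M = M} {e} e∈M with e ∈? M
... | yes _   = refl
... | no e∉M = contradiction e∈M e∉M

matchingColouring-≢0 : ∀ {k} {M : Subset k} {e} → matchingColouring M e ≢ 0 → e ∈ M
matchingColouring-≢0 {M = M} {e} ≢0 with e ∈? M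
... | yes e∈M = e∈M
... | no  _   = contradiction refl ≢0

module _ (G : Graph) {M : Subset (m G)} (matching : IsMatching G M) where

  private
    f₀ : EdgeColouring G
    f₀ = matchingColouring M

  nonzero-coloursAt-matchingColouring-constant : ∀ {v c c′} →
    c ∈ˡ nonzero (coloursAt G f₀ v) → c′ ∈ˡ nonzero (coloursAt G f₀ v) → c ≡ c′
  nonzero-coloursAt-matchingColouring-constant c∈ c′∈
    with ∈-filter⁻ nonzero? c∈ | ∈-filter⁻ nonzero? c′∈
  ... | c∈′ , c≢0 | c′∈′ , c′≢0 with ∈-coloursAt⁻ G f₀ c∈′ | ∈-coloursAt⁻ G f₀ c′∈′
  ... | e , v~e , refl | e′ , v~e′ , refl
    with matching e e′ (matchingColouring-≢0 c≢0) (matchingColouring-≢0 c′≢0) (_ , v~e , v~e′)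
  ... | refl = refl

  matchingColouring-SComposable : ∀ {q S} → 2 ≤ q → IsSComposable q G S f₀
  matchingColouring-SComposable 2≤q =
    (λ v → ≤-trans (deg-col≤2 v) 2≤q) , λ v _ → ≤-trans (deg-col⁺≤1 v) (∸-monoˡ-≤ 1 2≤q)
    where
    deg-col⁺≤1 : ∀ v → deg-col⁺ G f₀ v ≤ 1
    deg-col⁺≤1 v = Unique-constant⇒length≤1 (filter⁺ nonzero? (deduplicate-! (map f₀ (incidentEdges G v))))
                     (nonzero-coloursAt-matchingColouring-constant {v})
    deg-col≤2 : ∀ v → deg-col G f₀ v ≤ 2
    deg-col≤2 v = ≤-trans (Unique⇒length≤1+nonzero (deduplicate-! (map f₀ (incidentEdges G v))))
                          (s≤s (deg-col⁺≤1 v))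

  ∣M∣≤numNonzeroColours-matchingColouring : ∣ M ∣ ≤ numNonzeroColours G f₀
  ∣M∣≤numNonzeroColours-matchingColouring =
    subst (_≤ numNonzeroColours G f₀) (trans (length-map (suc ∘ toℕ) (members M)) (length-members M))
      (Unique-⊆⇒length≤ (map⁺ (toℕ-injective ∘ suc-injective) (members-unique M)) colours⊆)
    where
    colours⊆ : map (suc ∘ toℕ) (members M) ⊆ˡ nonzero (distinct (map f₀ (allFin (m G))))
    colours⊆ c∈ with ∈-map⁻ (suc ∘ toℕ) c∈
    ... | e , e∈ , refl = ∈-filter⁺ nonzero?
      (∈-deduplicate⁺ _≟_ (subst (_∈ˡ map f₀ (allFin (m G))) (matchingColouring-∈ (∈-members⁻ M e∈))
                                  (∈-map⁺ f₀ (∈-allFin e))))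
      λ ()

  ∣M∣≤χ′ₛ : ∀ {q S kS} → 2 ≤ q → IsChiQS q G S kS → ∣ M ∣ ≤ kS
  ∣M∣≤χ′ₛ 2≤q (_ , χ′ₛ-max) =
    ≤-trans ∣M∣≤numNonzeroColours-matchingColouring (χ′ₛ-max f₀ (matchingColouring-SComposable 2≤q))

module _ (G : Graph) {M : Subset (m G)} (maximal : IsMaximalMatching G M) where

  -- Otherwise M ∪ {e} would be a larger matching.
  maximalMatching-dominates : ∀ e → ∃ λ e′ → e′ ∈ M × ShareEnd G e e′
  maximalMatching-dominates e with any? (λ e′ → (e′ ∈? M) ×-dec shareEnd? G e e′)
  ... | yes found = found
  ... | no  none  = contradiction (e , e∈M , proj₁ (ends G e) , inj₁ refl , inj₁ refl) none
    where
    M+e-matching : IsMatching G (M ∪ ⁅ e ⁆)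
    M+e-matching a b a∈ b∈ a~b with x∈p∪q⁻ M ⁅ e ⁆ a∈ | x∈p∪q⁻ M ⁅ e ⁆ b∈
    ... | inj₁ a∈M | inj₁ b∈M = proj₁ maximal a b a∈M b∈M a~b
    ... | inj₁ a∈M | inj₂ b∈e with x∈⁅y⁆⇒x≡y e b∈e
    ...   | refl = contradiction (a , a∈M , shareEnd-sym G a~b) none
    M+e-matching a b a∈ b∈ a~b | inj₂ a∈e | inj₁ b∈M with x∈⁅y⁆⇒x≡y e a∈e
    ...   | refl = contradiction (b , b∈M , a~b) none
    M+e-matching a b a∈ b∈ a~b | inj₂ a∈e | inj₂ b∈e = trans (x∈⁅y⁆⇒x≡y e a∈e) (sym (x∈⁅y⁆⇒x≡y e b∈e))

    e∈M : e ∈ M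
    e∈M = proj₂ maximal (M ∪ ⁅ e ⁆) M+e-matching (p⊆p∪q ⁅ e ⁆) (x∈p∪q⁺ (inj₂ (x∈⁅x⁆ e)))

  endColours : EdgeColouring G → Fin (m G) → List ℕ
  endColours f e = coloursAt G f (proj₁ (ends G e)) ++ coloursAt G f (proj₂ (ends G e))

  numColours≤2q∣M∣ : ∀ {q f} → IsEdgeQColouring q G f → numColours G f ≤ 2 * q * ∣ M ∣
  numColours≤2q∣M∣ {q} {f} qf = begin
    numColours G f                                 ≤⟨ Unique-⊆⇒length≤ (deduplicate-! _) colours⊆ ⟩
    length (concatMap (endColours f) (members M))  ≤⟨ length-concatMap-≤ (endColours f) endColours≤2q (members M) ⟩
    2 * q * length (members M)                     ≡⟨ cong (2 * q *_) (length-members M) ⟩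
    2 * q * ∣ M ∣                                  ∎
    where
    open Data.Nat.Properties.≤-Reasoning

    endColours≤2q : ∀ e → length (endColours f e) ≤ 2 * q
    endColours≤2q e = begin
      length (endColours f e)           ≡⟨ length-++ (coloursAt G f u) ⟩
      deg-col G f u + deg-col G f w     ≤⟨ +-mono-≤ (qf u) (qf w) ⟩
      q + q                             ≡⟨ cong (q +_) (sym (+-identityʳ q)) ⟩
      2 * q                             ∎
      where
      u w : Fin (n G)
      u = proj₁ (ends G e)
      w = proj₂ (ends G e)

    at-end : ∀ {v e c} → Incident G v e → c ∈ˡ coloursAt G f v → c ∈ˡ endColours f e
    at-end (inj₁ refl) c∈ = ∈-++⁺ˡ c∈
    at-end {e = e} (inj₂ refl) c∈ = ∈-++⁺ʳ (coloursAt G f (proj₁ (ends G e))) c∈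

    colours⊆ : distinct (map f (allFin (m G))) ⊆ˡ concatMap (endColours f) (members M)
    colours⊆ c∈ with ∈-map⁻ f (∈-deduplicate⁻ _≟_ (map f (allFin (m G))) c∈)
    ... | e , _ , refl with maximalMatching-dominates e
    ... | e′ , e′∈M , v , v~e , v~e′ =
      ∈-concat⁺′ (at-end v~e′ (∈-coloursAt⁺ G f v~e)) (∈-map⁺ (endColours f) (∈-members⁺ e′∈M))

  χ′≤2q∣M∣ : ∀ {q k} → IsChiQ q G k → k ≤ 2 * q * ∣ M ∣
  χ′≤2q∣M∣ ((f , qf , refl) , _) = numColours≤2q∣M∣ qf

mainTheorem7 : (G : Graph) (S : Subset (n G)) (M : Subset (m G)) (q : ℕ) →
    IsMaximalMatching G M → 2 ≤ q →
    Σ ℕ λ kS → Σ ℕ λ k → IsChiQS q G S kS × IsChiQ q G k ×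
      (∣ M ∣ ≤ kS × kS ≤ k × k ≤ 2 * q * ∣ M ∣)
mainTheorem7 G S M q maximal 2≤q =
  let matching      = proj₁ maximal
      f₀-composable = matchingColouring-SComposable G matching {S = S} 2≤q
      kS , isχ′ₛ     = χ′ₛ-exists G f₀-composable
      k  , isχ′      = χ′-exists G (proj₁ f₀-composable)
  in kS , k , isχ′ₛ , isχ′ ,
     ∣M∣≤χ′ₛ G matching 2≤q isχ′ₛ , χ′ₛ≤χ′ G isχ′ₛ isχ′ , χ′≤2q∣M∣ G maximal isχ′
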